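{- Every finite $C^\infty$ word over $\{1,2\}$ is a subword of the Kolakoski sequence $S$ if and only if for every positive integer $n$ there is a $k$-normal prefix of $S$ for some $k>n$.
   Context: Words are over the alphabet $\{1,2\}$; $|v|$ is the length of $v$. For a finite or infinite word $v=a_1a_2\cdots$, its integral $v^{ -1}$ is obtained by replacing each letter $a_i$ by $a_i$ copies of the letter $1$ if $i$ is odd and by $a_i$ copies of the letter $2$ if $i$ is even. Set $v^0=v$, $v^{ -k}=(v^{ -(k-1)})^{ -1}$. The Kolakoski sequence $S=1221121221\cdots$ is the unique infinite word over $\{1,2\}$ with $S^{ -1}=S$. A prefix $w$ of $S$ is $k$-regular if $|w^{ -h}|$ is even for all $0\le h\le k$, and $k$-normal if it is $k$-regular but not $(k+1)$-regular. Derivative of a finite word $w=a_1\cdots a_n$: delete $a_1$ if $a_1\ne a_2$ and delete $a_n$ if $a_{n-1}\ne a_n$ (for $n\le 2$ with distinct letters, or $n\le1$, or the empty word, the derivative is the empty word); the derivative $w'$ is the sequence of lengths of the maximal runs of equal letters of the remaining word, and is a word over $\{1,2\}$ only if all these run lengths are $1$ or $2$. A finite word $w$ is $C^\infty$ if $w$ and all its iterated derivatives $w', w'', \dots$ are words over $\{1,2\}$ (i.e. at every stage all runs have length at most $2$). -}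

module Defs where

open import Data.Nat using (ℕ; zero; suc; _+_; _≡ᵇ_; _<_; _≤_)
open import Data.Nat.Divisibility using (_∣_)
open import Data.Bool using (Bool; true; false; if_then_else_; not)
open import Data.List using (List; []; _∷_; _++_; replicate; length; reverse; map; upTo)
open import Data.List.Relation.Unary.All using (All)
open import Data.Sum using (_⊎_)
open import Data.Product using (_×_; ∃)
open import Relation.Nullary using (¬_)
open import Relation.Binary.PropositionalEquality using (_≡_; refl)

Word : Set
Word = List ℕ

Over12 : Word → Set
Over12 w = All (λ a → a ≡ 1 ⊎ a ≡ 2) w

iter : {A : Set} → ℕ → (A → A) → A → A
iter zero    f x = x
iter (suc k) f x = f (iter k f x)

-- integral v^{-1}: the i-th letter a_i (1-based) becomes a_i copies of 1
-- if i is odd, a_i copies of 2 if i is even.  The Bool flag says whether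
-- the current position is odd.
integral' : Bool → Word → Word
integral' odd []      = []
integral' odd (a ∷ v) = replicate a (if odd then 1 else 2) ++ integral' (not odd) v

integral : Word → Word
integral = integral' true

integralPow : ℕ → Word → Word
integralPow h = iter h integral

-- nth letter of a finite word (0-based), with a dummy default
at : Word → ℕ → ℕ
at []      n       = 0
at (a ∷ w) zero    = a
at (a ∷ w) (suc n) = at w n

-- The Kolakoski sequence S = 1221121221..., the unique infinite word over
-- {1,2} with S^{-1} = S.  Concretely: starting from the prefix 122 of S,
-- integrating a prefix of S yields a longer prefix of S, and the k-th
-- iterate has length ≥ k+3; S(n) (0-based) is read off from the n-th iterate.
S : ℕ → ℕ
S n = at (integralPow n (1 ∷ 2 ∷ 2 ∷ [])) n

prefix : ℕ → Word
prefix m = map S (upTo m)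

S-check : prefix 10 ≡ 1 ∷ 2 ∷ 2 ∷ 1 ∷ 1 ∷ 2 ∷ 1 ∷ 2 ∷ 2 ∷ 1 ∷ []
S-check = refl

SubwordOfS : Word → Set
SubwordOfS w = ∃ λ i → w ≡ map (λ j → S (i + j)) (upTo (length w))

Regular : ℕ → Word → Set
Regular k w = ∀ h → h ≤ k → 2 ∣ length (integralPow h w)

Normal : ℕ → Word → Set
Normal k w = Regular k w × ¬ Regular (suc k) w

runs' : ℕ → ℕ → Word → List ℕ
runs' a c []      = c ∷ []
runs' a c (b ∷ r) = if a ≡ᵇ b then runs' a (suc c) r else c ∷ runs' b 1 r

runs : Word → List ℕ
runs []      = []
runs (a ∷ r) = runs' a 1 r

trimL : Word → Word
trimL (a ∷ b ∷ r) = if a ≡ᵇ b then a ∷ b ∷ r else b ∷ r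
trimL w           = w

trimR : Word → Word
trimR w = reverse (trimL (reverse w))

deriv : Word → Word
deriv []              = []
deriv (a ∷ [])        = []
deriv (a ∷ b ∷ [])    = if a ≡ᵇ b then 2 ∷ [] else []
deriv (a ∷ b ∷ c ∷ r) = runs (trimR (trimL (a ∷ b ∷ c ∷ r)))

Cinf : Word → Set
Cinf w = ∀ k → Over12 (iter k deriv w)

-- S is its own integral.  Hence if a word x occurs in S at position L, its integral,
-- read with the flag given by the parity of L, occurs at position runStart L, the
-- length of the integral of the prefix of length L; conversely, an occurrence of a
-- padded integral of 1 ∷ x ++ 1 ∷ [] can be traced back to an occurrence of x.  So the
-- parities of the lengths |(prefix m)^{-h}| decide which integrals of a factor at m
-- occur in S.
--
-- (⇒) For every parity pattern τ, iterated padded integrals of the word 1, with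
-- suitably chosen flags, are C∞; tracing an occurrence of the h-th one back to its
-- bottom letter yields m with |(prefix m)^{-t}| of parity τ t for all t < h, and
-- τ t = (t ≤ k) gives a k-normal prefix.
--
-- (⇐) At a k-normal m the first k+1 integrals of S(m) S(m+1) are read with the flag
-- of S itself and the next one with the opposite flag, so the complement of a long
-- prefix of S, and hence of any factor of S, occurs in S.  A C∞ word of length ≥ 3
-- is a factor of a padded integral of its shorter derivative, which occurs by
-- induction; so the word or its complement occurs, and therefore the word does.

module Submission where

open import Defs
open import Data.Bool using (Bool; true; false; not; if_then_else_; _xor_; T) renaming (_≟_ to _≟ᵇ_)
open import Data.Bool.Properties
  using (not-involutive; not-distribˡ-xor; xor-assoc; xor-same; xor-identityʳ; ¬-not)
open import Data.Empty using (⊥-elim)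
open import Data.List using ([]; _∷_; _++_; replicate; length; map; upTo; applyUpTo; reverse)
open import Data.List.Properties
  using (++-assoc; ++-identityʳ; length-++; length-map; length-replicate; map-++; map-replicate; map-applyUpTo;
         ∷-injective; ∷-injectiveˡ; ∷-injectiveʳ; ∷ʳ-injectiveʳ; reverse-++; reverse-involutive)
open import Data.List.Relation.Unary.All using (All; []; _∷_)
open import Data.List.Relation.Unary.All.Properties using (++⁺; ++⁻ˡ; ++⁻ʳ)
open import Data.Nat using (ℕ; zero; suc; _+_; _∸_; _<_; _≤_; _≤?_; _≡ᵇ_; z≤n; s≤s)
open import Data.Nat.Divisibility using (_∣_; divides; ∣-refl; ∣m+n∣m⇒∣n; ∣m∣n⇒∣m+n)
open import Data.Nat.ListAction using (sum)
open import Data.Nat.Properties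
open import Data.Product using (_×_; _,_; proj₁; proj₂; ∃)
open import Data.Sum using (_⊎_; inj₁; inj₂)
open import Data.Unit using (tt)
open import Function.Base using (_∘_)
open import Function.Bundles using (_⇔_; mk⇔)
open import Relation.Binary.Definitions using (tri<; tri≈; tri>)
open import Relation.Binary.PropositionalEquality
open import Relation.Nullary using (¬_; Dec; yes; no; does)
open import Relation.Nullary.Decidable using (dec-true; dec-false)

Is12 : ℕ → Set
Is12 a = a ≡ 1 ⊎ a ≡ 2

letter : Bool → ℕ
letter b = if b then 1 else 2

letter-is12 : ∀ b → Is12 (letter b)
letter-is12 true  = inj₁ refl
letter-is12 false = inj₂ refl

letter-injective : ∀ {b c} → letter b ≡ letter c → b ≡ c
letter-injective {true}  {true}  _ = refl
letter-injective {false} {false} _ = refl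

letter≢letter-not : ∀ b → letter b ≢ letter (not b)
letter≢letter-not true  ()
letter≢letter-not false ()

is12⇒letter : ∀ {a} → Is12 a → ∃ λ β → a ≡ letter β
is12⇒letter (inj₁ refl) = true , refl
is12⇒letter (inj₂ refl) = false , refl

letter-or-not : ∀ β {a} → Is12 a → a ≡ letter β ⊎ a ≡ letter (not β)
letter-or-not true  (inj₁ refl) = inj₁ refl
letter-or-not true  (inj₂ refl) = inj₂ refl
letter-or-not false (inj₁ refl) = inj₂ refl
letter-or-not false (inj₂ refl) = inj₁ refl

compl : ℕ → ℕ
compl a = 3 ∸ a

complement : Word → Word
complement = map compl

compl-letter : ∀ b → compl (letter b) ≡ letter (not b)
compl-letter true  = refl
compl-letter false = refl

complement-involutive : ∀ {w} → Over12 w → complement (complement w) ≡ w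
complement-involutive []                 = refl
complement-involutive (inj₁ refl ∷ w12) = cong (1 ∷_) (complement-involutive w12)
complement-involutive (inj₂ refl ∷ w12) = cong (2 ∷_) (complement-involutive w12)

complement-++₃ : ∀ l w r → complement (l ++ w ++ r) ≡ complement l ++ complement w ++ complement r
complement-++₃ l w r = trans (map-++ compl l (w ++ r)) (cong (complement l ++_) (map-++ compl w r))

iter-shift : ∀ {A : Set} n (f : A → A) x → iter (suc n) f x ≡ iter n f (f x)
iter-shift zero    f x = refl
iter-shift (suc n) f x = cong f (iter-shift n f x)

iter-+ : ∀ {A : Set} m n (f : A → A) x → iter (m + n) f x ≡ iter m f (iter n f x)
iter-+ zero    n f x = refl
iter-+ (suc m) n f x = cong f (iter-+ m n f x)

-- The flag integral' uses for the letter at 0-based index n.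
isEven : ℕ → Bool
isEven n = iter n not true

iter-not : ∀ n b → iter n not b ≡ not (isEven n) xor b
iter-not zero    b = refl
iter-not (suc n) b = trans (cong not (iter-not n b)) (not-distribˡ-xor (not (isEven n)) b)

isEven-+ : ∀ m n → isEven (m + n) ≡ not (isEven m xor isEven n)
isEven-+ m n = trans (iter-+ m n not true)
                     (trans (iter-not m (isEven n)) (sym (not-distribˡ-xor (isEven m) (isEven n))))

isEven-+-xor : ∀ m n b → isEven m ≡ not (b xor isEven n) → isEven (m + n) ≡ b
isEven-+-xor m n b parity-m = begin
  isEven (m + n)                          ≡⟨ isEven-+ m n ⟩
  not (isEven m xor isEven n)             ≡⟨ cong (λ c → not (c xor isEven n)) parity-m ⟩
  not (not (b xor isEven n) xor isEven n) ≡⟨ not-distribˡ-xor (not (b xor isEven n)) (isEven n) ⟩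
  not (not (b xor isEven n)) xor isEven n ≡⟨ cong (_xor isEven n) (not-involutive (b xor isEven n)) ⟩
  (b xor isEven n) xor isEven n           ≡⟨ xor-assoc b (isEven n) (isEven n) ⟩
  b xor (isEven n xor isEven n)           ≡⟨ cong (b xor_) (xor-same (isEven n)) ⟩
  b xor false                             ≡⟨ xor-identityʳ b ⟩
  b                                       ∎
  where open ≡-Reasoning

isEven⇒2∣ : ∀ n → isEven n ≡ true → 2 ∣ n
isEven⇒2∣ zero          _ = divides 0 refl
isEven⇒2∣ (suc zero)    ()
isEven⇒2∣ (suc (suc n)) e = ∣m∣n⇒∣m+n ∣-refl (isEven⇒2∣ n (trans (sym (not-involutive _)) e))

2∣⇒isEven : ∀ n → 2 ∣ n → isEven n ≡ true
2∣⇒isEven zero          _             = refl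
2∣⇒isEven (suc zero)    (divides zero ())
2∣⇒isEven (suc zero)    (divides (suc q) ())
2∣⇒isEven (suc (suc n)) d = trans (not-involutive _) (2∣⇒isEven n (∣m+n∣m⇒∣n d ∣-refl))

odd⇒positive : ∀ {n} → isEven n ≡ false → 1 ≤ n
odd⇒positive {zero}  ()
odd⇒positive {suc n} _ = s≤s z≤n

++-injective-≡length : ∀ (u u' : Word) {v v'} → length u ≡ length u' →
                       u ++ v ≡ u' ++ v' → u ≡ u' × v ≡ v'
++-injective-≡length []      []       _ e = refl , e
++-injective-≡length (a ∷ u) (a' ∷ u') l e with ∷-injective e
... | refl , e′ with ++-injective-≡length u u' (suc-injective l) e′
...   | refl , v≡v' = refl , v≡v'

replicate-+ : ∀ m n (a : ℕ) → replicate (m + n) a ≡ replicate m a ++ replicate n a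
replicate-+ zero    n a = refl
replicate-+ (suc m) n a = cong (a ∷_) (replicate-+ m n a)

replicate-suc-++ : ∀ n (a : ℕ) r → replicate (suc n) a ++ r ≡ replicate n a ++ a ∷ r
replicate-suc-++ zero    a r = refl
replicate-suc-++ (suc n) a r = cong (a ∷_) (replicate-suc-++ n a r)

at-++ˡ : ∀ (u v : Word) {j} → j < length u → at (u ++ v) j ≡ at u j
at-++ˡ (a ∷ u) v {zero}  _         = refl
at-++ˡ (a ∷ u) v {suc j} (s≤s j<u) = at-++ˡ u v j<u

at-replicate : ∀ n (a : ℕ) {j} → j < n → at (replicate n a) j ≡ a
at-replicate (suc n) a {zero}  _         = refl
at-replicate (suc n) a {suc j} (s≤s j<n) = at-replicate n a j<n

at-All : ∀ {P : ℕ → Set} {v : Word} {j} → All P v → j < length v → P (at v j)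
at-All {j = zero}  (p ∷ _)  _         = p
at-All {j = suc j} (_ ∷ ps) (s≤s j<v) = at-All ps j<v

≡-by-at : ∀ (u v : Word) → length u ≡ length v →
          (∀ j → j < length u → at u j ≡ at v j) → u ≡ v
≡-by-at []      []      _ _  = refl
≡-by-at (a ∷ u) (b ∷ v) l at≗ =
  cong₂ _∷_ (at≗ 0 (s≤s z≤n)) (≡-by-at u v (suc-injective l) (λ j j<u → at≗ (suc j) (s≤s j<u)))

_≼_ : Word → Word → Set
u ≼ v = ∃ λ t → v ≡ u ++ t

≼-refl : ∀ u → u ≼ u
≼-refl u = [] , sym (++-identityʳ u)

≼-trans : ∀ {u v w} → u ≼ v → v ≼ w → u ≼ w
≼-trans {u} (t , refl) (t' , refl) = t ++ t' , ++-assoc u t t'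

at-≼ : ∀ {u v j} → u ≼ v → j < length u → at v j ≡ at u j
at-≼ {u} (t , refl) j<u = at-++ˡ u t j<u

over12-replicate : ∀ n {a} → Is12 a → Over12 (replicate n a)
over12-replicate zero    _ = []
over12-replicate (suc n) p = p ∷ over12-replicate n p

length≤sum : ∀ {v} → Over12 v → length v ≤ sum v
length≤sum []                = z≤n
length≤sum (inj₁ refl ∷ v12) = s≤s (length≤sum v12)
length≤sum (inj₂ refl ∷ v12) = s≤s (m≤n⇒m≤1+n (length≤sum v12))

integral'-++ : ∀ b (u v : Word) → integral' b (u ++ v) ≡ integral' b u ++ integral' (iter (length u) not b) v
integral'-++ b []      v = refl
integral'-++ b (a ∷ u) v = begin
  replicate a (letter b) ++ integral' (not b) (u ++ v)
    ≡⟨ cong (replicate a (letter b) ++_) (integral'-++ (not b) u v) ⟩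
  replicate a (letter b) ++ (integral' (not b) u ++ integral' (iter (length u) not (not b)) v)
    ≡⟨ ++-assoc (replicate a (letter b)) _ _ ⟨
  integral' b (a ∷ u) ++ integral' (iter (length u) not (not b)) v
    ≡⟨ cong (λ c → integral' b (a ∷ u) ++ integral' c v) (iter-shift (length u) not b) ⟨
  integral' b (a ∷ u) ++ integral' (iter (length (a ∷ u)) not b) v ∎
  where open ≡-Reasoning

integral'-≼ : ∀ b {u v} → u ≼ v → integral' b u ≼ integral' b v
integral'-≼ b {u} (t , refl) = _ , integral'-++ b u t

length-integral' : ∀ b v → length (integral' b v) ≡ sum v
length-integral' b []      = refl
length-integral' b (a ∷ v) = begin
  length (replicate a (letter b) ++ integral' (not b) v) ≡⟨ length-++ (replicate a (letter b)) ⟩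
  length (replicate a (letter b)) + length (integral' (not b) v)
    ≡⟨ cong₂ _+_ (length-replicate a) (length-integral' (not b) v) ⟩
  a + sum v ∎
  where open ≡-Reasoning

over12-integral' : ∀ b v → Over12 (integral' b v)
over12-integral' b []      = []
over12-integral' b (a ∷ v) = ++⁺ (over12-replicate a (letter-is12 b)) (over12-integral' (not b) v)

integral'-not : ∀ b v → integral' (not b) v ≡ complement (integral' b v)
integral'-not b []      = refl
integral'-not b (a ∷ v) = begin
  replicate a (letter (not b)) ++ integral' (not (not b)) v
    ≡⟨ cong₂ (λ c u → replicate a c ++ u) (sym (compl-letter b)) (integral'-not (not b) v) ⟩
  replicate a (compl (letter b)) ++ complement (integral' (not b) v)
    ≡⟨ cong (_++ complement (integral' (not b) v)) (map-replicate compl a (letter b)) ⟨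
  complement (replicate a (letter b)) ++ complement (integral' (not b) v)
    ≡⟨ map-++ compl (replicate a (letter b)) _ ⟨
  complement (integral' b (a ∷ v)) ∎
  where open ≡-Reasoning

integral'-last : ∀ β {d v} → Is12 d → Over12 v →
                 ∃ λ X → integral' β (d ∷ v) ≡ X ++ letter (iter (length v) not β) ∷ []
integral'-last β (inj₁ refl) []          = [] , refl
integral'-last β (inj₂ refl) []          = letter β ∷ [] , refl
integral'-last β {d} {e ∷ v} d12 (e12 ∷ v12) with integral'-last (not β) e12 v12
... | X , eq = replicate d (letter β) ++ X , (begin
  replicate d (letter β) ++ integral' (not β) (e ∷ v)
    ≡⟨ cong (replicate d (letter β) ++_) eq ⟩
  replicate d (letter β) ++ X ++ letter (iter (length v) not (not β)) ∷ []
    ≡⟨ ++-assoc (replicate d (letter β)) X _ ⟨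
  (replicate d (letter β) ++ X) ++ letter (iter (length v) not (not β)) ∷ []
    ≡⟨ cong (λ b → (replicate d (letter β) ++ X) ++ letter b ∷ []) (iter-shift (length v) not β) ⟨
  (replicate d (letter β) ++ X) ++ letter (iter (length (e ∷ v)) not β) ∷ [] ∎)
  where open ≡-Reasoning

integral'-snoc : ∀ β {d D X γ} c → Is12 d → Over12 D → integral' β (d ∷ D) ≡ X ++ letter γ ∷ [] →
                 integral' β ((d ∷ D) ++ c ∷ []) ≡ integral' β (d ∷ D) ++ replicate c (letter (not γ))
integral'-snoc β {d} {D} {X} {γ} c d12 D12 ends-γ with integral'-last β d12 D12
... | X′ , ends-last = begin
  integral' β ((d ∷ D) ++ c ∷ [])
    ≡⟨ integral'-++ β (d ∷ D) (c ∷ []) ⟩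
  integral' β (d ∷ D) ++ replicate c (letter (not (iter (length D) not β))) ++ []
    ≡⟨ cong (λ b → integral' β (d ∷ D) ++ replicate c (letter (not b)) ++ []) last≡γ ⟩
  integral' β (d ∷ D) ++ replicate c (letter (not γ)) ++ []
    ≡⟨ cong (integral' β (d ∷ D) ++_) (++-identityʳ _) ⟩
  integral' β (d ∷ D) ++ replicate c (letter (not γ)) ∎
  where
  open ≡-Reasoning
  last≡γ : iter (length D) not β ≡ γ
  last≡γ = letter-injective (∷ʳ-injectiveʳ X′ X (trans (sym ends-last) ends-γ))

integral'-padded-head : ∀ {z} b → Over12 z → ∃ λ rest → integral' b (z ++ 1 ∷ []) ≡ letter b ∷ rest
integral'-padded-head b []             = _ , refl
integral'-padded-head b (inj₁ refl ∷ _) = _ , refl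
integral'-padded-head b (inj₂ refl ∷ _) = _ , refl

-- Occurrences in S

window : ℕ → ℕ → Word
window i zero    = []
window i (suc n) = S i ∷ window (suc i) n

OccursAt : Word → ℕ → Set
OccursAt w i = w ≡ window i (length w)

length-window : ∀ i n → length (window i n) ≡ n
length-window i zero    = refl
length-window i (suc n) = cong suc (length-window (suc i) n)

at-window : ∀ i n {j} → j < n → at (window i n) j ≡ S (i + j)
at-window i (suc n) {zero}  _         = cong S (sym (+-identityʳ i))
at-window i (suc n) {suc j} (s≤s j<n) = trans (at-window (suc i) n j<n) (cong S (sym (+-suc i j)))

window-+ : ∀ i m n → window i (m + n) ≡ window i m ++ window (i + m) n
window-+ i zero    n = cong (λ k → window k n) (sym (+-identityʳ i))
window-+ i (suc m) n = cong (S i ∷_) (trans (window-+ (suc i) m n)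
                                            (cong (λ k → window (suc i) m ++ window k n) (sym (+-suc i m))))

window≡applyUpTo : ∀ i n (f : ℕ → ℕ) → (∀ j → f j ≡ S (i + j)) → window i n ≡ applyUpTo f n
window≡applyUpTo i zero    f _  = refl
window≡applyUpTo i (suc n) f f≗ =
  cong₂ _∷_ (trans (cong S (sym (+-identityʳ i))) (sym (f≗ 0)))
            (window≡applyUpTo (suc i) n (λ j → f (suc j)) (λ j → trans (f≗ (suc j)) (cong S (+-suc i j))))

window≡map : ∀ i n → window i n ≡ map (λ j → S (i + j)) (upTo n)
window≡map i n = trans (window≡applyUpTo i n _ (λ _ → refl)) (sym (map-applyUpTo (λ j → j) _ n))

prefix≡window : ∀ n → prefix n ≡ window 0 n
prefix≡window n = sym (window≡map 0 n)

length-prefix : ∀ n → length (prefix n) ≡ n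
length-prefix n = trans (cong length (prefix≡window n)) (length-window 0 n)

prefix-+ : ∀ m n → prefix (m + n) ≡ prefix m ++ window m n
prefix-+ m n = begin
  prefix (m + n)                ≡⟨ prefix≡window (m + n) ⟩
  window 0 (m + n)              ≡⟨ window-+ 0 m n ⟩
  window 0 m ++ window m n      ≡⟨ cong (_++ window m n) (prefix≡window m) ⟨
  prefix m ++ window m n        ∎
  where open ≡-Reasoning

prefix-≼ : ∀ {m n} → m ≤ n → prefix m ≼ prefix n
prefix-≼ {m} {n} m≤n =
  window m (n ∸ m) , trans (cong prefix (sym (m+[n∸m]≡n m≤n))) (prefix-+ m (n ∸ m))

≡window⇒occursAt : ∀ {w i n} → w ≡ window i n → OccursAt w i
≡window⇒occursAt {i = i} {n} e = trans e (cong (window i) (sym (trans (cong length e) (length-window i n))))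

occursAt-++ : ∀ {u v i} → OccursAt u i → OccursAt v (i + length u) → OccursAt (u ++ v) i
occursAt-++ {u} {v} {i} u-at v-at = begin
  u ++ v                                            ≡⟨ cong₂ _++_ u-at v-at ⟩
  window i (length u) ++ window (i + length u) (length v) ≡⟨ window-+ i (length u) (length v) ⟨
  window i (length u + length v)                    ≡⟨ cong (window i) (length-++ u) ⟨
  window i (length (u ++ v))                        ∎
  where open ≡-Reasoning

occursAt-++⁻ : ∀ u {v i} → OccursAt (u ++ v) i → OccursAt u i × OccursAt v (i + length u)
occursAt-++⁻ u {v} {i} uv-at =
  ++-injective-≡length u (window i (length u)) (sym (length-window i (length u)))
    (trans uv-at (trans (cong (window i) (length-++ u)) (window-+ i (length u) (length v))))

occursAt-infix : ∀ l {w r i} → OccursAt (l ++ w ++ r) i → OccursAt w (i + length l)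
occursAt-infix l {w} lwr-at = proj₁ (occursAt-++⁻ w (proj₂ (occursAt-++⁻ l lwr-at)))

occursAt-at : ∀ {w i j} → OccursAt w i → j < length w → at w j ≡ S (i + j)
occursAt-at {w} {i} w-at j<w = trans (cong (λ v → at v _) w-at) (at-window i (length w) j<w)

occursAt-prefix : ∀ n → OccursAt (prefix n) 0
occursAt-prefix n = ≡window⇒occursAt (prefix≡window n)

occursAt⇒prefix-++ : ∀ {w i} → OccursAt w i → prefix (i + length w) ≡ prefix i ++ w
occursAt⇒prefix-++ {w} {i} w-at = trans (prefix-+ i (length w)) (cong (prefix i ++_) (sym w-at))

prefix-++⇒occursAt : ∀ {u w m} → u ++ w ≡ prefix m → OccursAt w (length u)
prefix-++⇒occursAt {u} e = proj₂ (occursAt-++⁻ u (≡window⇒occursAt (trans e (prefix≡window _))))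

prefix-++⇒prefix : ∀ {u w m} → u ++ w ≡ prefix m → u ≡ prefix (length u)
prefix-++⇒prefix {u} e =
  trans (proj₁ (occursAt-++⁻ u (≡window⇒occursAt (trans e (prefix≡window _))))) (sym (prefix≡window _))

Occurs : Word → Set
Occurs w = ∃ λ i → OccursAt w i

OccursInside : Word → Set
OccursInside w = ∃ λ i → OccursAt w (suc i)

subwordOfS⇒occurs : ∀ {w} → SubwordOfS w → Occurs w
subwordOfS⇒occurs (i , e) = i , trans e (sym (window≡map i _))

occursAt⇒subwordOfS : ∀ {w i} → OccursAt w i → SubwordOfS w
occursAt⇒subwordOfS {i = i} w-at = i , trans w-at (window≡map i _)

complement-prefix-occursAt⇒ : ∀ {A L u i} → OccursAt (complement (prefix A)) L → OccursAt u i →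
                              i + length u ≤ A → OccursAt (complement u) (L + i)
complement-prefix-occursAt⇒ {A} {L} {u} {i} cA-at u-at i+u≤A =
  subst (λ n → OccursAt (complement u) (L + n)) (trans (length-map compl (prefix i)) (length-prefix i))
        (occursAt-infix (complement (prefix i)) {complement u} {complement rest} {L}
          (subst (λ v → OccursAt v L) (trans (cong complement prefix-split) (complement-++₃ (prefix i) u rest))
                 cA-at))
  where
  rest = proj₁ (prefix-≼ i+u≤A)
  prefix-split : prefix A ≡ prefix i ++ u ++ rest
  prefix-split = trans (proj₂ (prefix-≼ i+u≤A))
                       (trans (cong (_++ rest) (occursAt⇒prefix-++ u-at)) (++-assoc (prefix i) u rest))

-- The Kolakoski sequence as the limit of its approximations

seed : Word
seed = 1 ∷ 2 ∷ 2 ∷ []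

approx : ℕ → Word
approx k = integralPow k seed

approx-≼-suc : ∀ k → approx k ≼ approx (suc k)
approx-≼-suc zero    = 1 ∷ 1 ∷ [] , refl
approx-≼-suc (suc k) = integral'-≼ true (approx-≼-suc k)

approx-≼-+ : ∀ m d → approx m ≼ approx (d + m)
approx-≼-+ m zero    = ≼-refl (approx m)
approx-≼-+ m (suc d) = ≼-trans (approx-≼-+ m d) (approx-≼-suc (d + m))

approx-mono : ∀ {m n} → m ≤ n → approx m ≼ approx n
approx-mono {m} {n} m≤n = subst (λ k → approx m ≼ approx k) (m∸n+n≡m m≤n) (approx-≼-+ m (n ∸ m))

over12-approx : ∀ k → Over12 (approx k)
over12-approx zero    = inj₁ refl ∷ inj₂ refl ∷ inj₂ refl ∷ []
over12-approx (suc k) = over12-integral' true (approx k)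

length-approx : ∀ k → 3 + k ≤ length (approx k)
length-approx zero    = ≤-refl
length-approx (suc k) with approx-mono {0} {k} z≤n
... | t , e = begin
  4 + k                            ≤⟨ +-monoʳ-≤ 1 (length-approx k) ⟩
  1 + length (approx k)            ≡⟨ cong (λ v → 1 + length v) e ⟩
  4 + length t                     ≤⟨ +-monoʳ-≤ 4 (m≤n⇒m≤1+n (length≤sum t12)) ⟩
  5 + sum t                        ≡⟨ cong sum e ⟨
  sum (approx k)                   ≡⟨ length-integral' true (approx k) ⟨
  length (approx (suc k))          ∎
  where
  open ≤-Reasoning
  t12 : Over12 t
  t12 = ++⁻ʳ seed (subst Over12 e (over12-approx k))

<length-approx : ∀ j → j < length (approx j)
<length-approx j = ≤-trans (s≤s (m≤n+m j 2)) (length-approx j)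

at-approx : ∀ k {j} → j < length (approx k) → at (approx k) j ≡ S j
at-approx k {j} j<k with ≤-total j k
... | inj₁ j≤k = at-≼ (approx-mono j≤k) (<length-approx j)
... | inj₂ k≤j = sym (at-≼ (approx-mono k≤j) j<k)

approx≡prefix : ∀ k → approx k ≡ prefix (length (approx k))
approx≡prefix k = ≡-by-at _ _ (sym (length-prefix _)) λ j j<k →
  trans (at-approx k j<k)
        (sym (occursAt-at (occursAt-prefix (length (approx k))) (subst (j <_) (sym (length-prefix _)) j<k)))

prefix≼approx : ∀ n → prefix n ≼ approx n
prefix≼approx n = subst (prefix n ≼_) (sym (approx≡prefix n)) (prefix-≼ (<⇒≤ (<length-approx n)))

S-is12 : ∀ j → Is12 (S j)
S-is12 j = at-All (over12-approx j) (<length-approx j)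

S-pos : ∀ j → 1 ≤ S j
S-pos j with S-is12 j
... | inj₁ e = ≤-reflexive (sym e)
... | inj₂ e = subst (1 ≤_) (sym e) (s≤s z≤n)

-- Runs of S

runStart : ℕ → ℕ
runStart zero    = 0
runStart (suc n) = runStart n + S n

runStart-+ : ∀ i n → runStart (i + n) ≡ runStart i + sum (window i n)
runStart-+ i zero    = trans (cong runStart (+-identityʳ i)) (sym (+-identityʳ (runStart i)))
runStart-+ i (suc n) = begin
  runStart (i + suc n)                              ≡⟨ cong runStart (+-suc i n) ⟩
  runStart (suc i + n)                              ≡⟨ runStart-+ (suc i) n ⟩
  runStart i + S i + sum (window (suc i) n)         ≡⟨ +-assoc (runStart i) (S i) _ ⟩
  runStart i + sum (window i (suc n))               ∎
  where open ≡-Reasoning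

runStart-occursAt : ∀ {v i} → OccursAt v i → runStart (i + length v) ≡ runStart i + sum v
runStart-occursAt {v} {i} v-at = trans (runStart-+ i (length v)) (cong (λ w → runStart i + sum w) (sym v-at))

integral-prefix : ∀ n → integral (prefix n) ≡ prefix (runStart n)
integral-prefix n with prefix≼approx n
... | t , e = begin
  integral (prefix n)                           ≡⟨ prefix-++⇒prefix approx-suc ⟩
  prefix (length (integral (prefix n)))         ≡⟨ cong prefix (length-integral' true (prefix n)) ⟩
  prefix (sum (prefix n))                       ≡⟨ cong prefix (runStart-occursAt (occursAt-prefix n)) ⟨
  prefix (runStart (length (prefix n)))         ≡⟨ cong (λ m → prefix (runStart m)) (length-prefix n) ⟩
  prefix (runStart n)                           ∎
  where
  open ≡-Reasoning
  approx-suc : integral (prefix n) ++ _ ≡ prefix (length (approx (suc n)))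
  approx-suc = trans (sym (integral'-++ true (prefix n) t))
                     (trans (cong integral (sym e)) (approx≡prefix (suc n)))

integralPow-prefix : ∀ h m → integralPow h (prefix m) ≡ prefix (iter h runStart m)
integralPow-prefix zero    m = refl
integralPow-prefix (suc h) m =
  trans (cong integral (integralPow-prefix h m)) (integral-prefix (iter h runStart m))

length-integralPow-prefix : ∀ h m → length (integralPow h (prefix m)) ≡ iter h runStart m
length-integralPow-prefix h m = trans (cong length (integralPow-prefix h m)) (length-prefix _)

occursAt-integral : ∀ {x L} → OccursAt x L → OccursAt (integral' (isEven L) x) (runStart L)
occursAt-integral {x} {L} x-at = subst (OccursAt _) (length-prefix (runStart L)) (prefix-++⇒occursAt split)
  where
  open ≡-Reasoning
  split : prefix (runStart L) ++ integral' (isEven L) x ≡ prefix (runStart (L + length x))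
  split = begin
    prefix (runStart L) ++ integral' (isEven L) x
      ≡⟨ cong₂ (λ u b → u ++ integral' b x) (integral-prefix L) (cong isEven (length-prefix L)) ⟨
    integral (prefix L) ++ integral' (isEven (length (prefix L))) x
      ≡⟨ integral'-++ true (prefix L) x ⟨
    integral (prefix L ++ x)              ≡⟨ cong integral (occursAt⇒prefix-++ x-at) ⟨
    integral (prefix (L + length x))      ≡⟨ integral-prefix (L + length x) ⟩
    prefix (runStart (L + length x))      ∎

occursAt-integralPow : ∀ h {x L} → OccursAt x L → (∀ t → t < h → isEven (iter t runStart L) ≡ true) →
                       OccursAt (integralPow h x) (iter h runStart L)
occursAt-integralPow zero    x-at _    = x-at
occursAt-integralPow (suc h) {x} {L} x-at even =
  subst (λ b → OccursAt (integral' b (integralPow h x)) (runStart (iter h runStart L))) (even h ≤-refl)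
        (occursAt-integral {integralPow h x} {iter h runStart L}
          (occursAt-integralPow h x-at (λ t t<h → even t (m≤n⇒m≤1+n t<h))))

integralPow-prefix-≼ : ∀ h {A v} → prefix A ≼ v → prefix (iter h runStart A) ≼ integralPow h v
integralPow-prefix-≼ zero    A≼v = A≼v
integralPow-prefix-≼ (suc h) {A} A≼v =
  subst (_≼ integralPow (suc h) _) (integral-prefix (iter h runStart A))
        (integral'-≼ true (integralPow-prefix-≼ h A≼v))

prefix2≼integralPow2 : ∀ {a b} → Is12 a → Is12 b → prefix 2 ≼ integralPow 2 (a ∷ b ∷ [])
prefix2≼integralPow2 (inj₁ refl) (inj₁ refl) = _ , refl
prefix2≼integralPow2 (inj₁ refl) (inj₂ refl) = _ , refl
prefix2≼integralPow2 (inj₂ refl) (inj₁ refl) = _ , refl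
prefix2≼integralPow2 (inj₂ refl) (inj₂ refl) = _ , refl

occursAt-replicate⇒ : ∀ {c a i} → OccursAt (replicate c a) i → ∀ {t} → t < c → S (i + t) ≡ a
occursAt-replicate⇒ {c} {a} r-at t<c =
  trans (sym (occursAt-at r-at (subst (_ <_) (sym (length-replicate c)) t<c))) (at-replicate c a t<c)

run-occursAt : ∀ j → OccursAt (replicate (S j) (letter (isEven j))) (runStart j)
run-occursAt j = proj₁ (occursAt-++⁻ (replicate (S j) _) (occursAt-integral {S j ∷ []} {j} refl))

runLetter : ∀ j {t} → t < S j → S (runStart j + t) ≡ letter (isEven j)
runLetter j = occursAt-replicate⇒ (run-occursAt j)

locate : ∀ x → ∃ λ j → runStart j ≤ x × x < runStart (suc j)
locate zero = 0 , z≤n , S-pos 0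
locate (suc x) with locate x
... | j , j≤x , x<j+1 with m≤n⇒m<n∨m≡n x<j+1
...   | inj₁ x+1<j+1 = j , m≤n⇒m≤1+n j≤x , x+1<j+1
...   | inj₂ x+1≡j+1 = suc j , ≤-reflexive (sym x+1≡j+1) ,
                       subst (_< runStart (suc (suc j))) (sym x+1≡j+1) (m<m+n _ (S-pos (suc j)))

run-boundary : ∀ q → S q ≢ S (suc q) → ∃ λ j → runStart j ≡ suc q
run-boundary q Sq≢Sq+1 with locate (suc q)
... | j , j≤q+1 , q+1<j+1 with m≤n⇒m<n∨m≡n j≤q+1
...   | inj₂ j≡q+1     = j , j≡q+1
...   | inj₁ (s≤s j≤q) = ⊥-elim (Sq≢Sq+1 (trans Sq≡ (sym Sq+1≡)))
  where
  t = q ∸ runStart j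
  start+t≡q : runStart j + t ≡ q
  start+t≡q = m+[n∸m]≡n j≤q
  start+t+1≡q+1 : runStart j + suc t ≡ suc q
  start+t+1≡q+1 = trans (+-suc (runStart j) t) (cong suc start+t≡q)
  t+1<Sj : suc t < S j
  t+1<Sj = +-cancelˡ-< (runStart j) (suc t) (S j) (subst (_< runStart (suc j)) (sym start+t+1≡q+1) q+1<j+1)
  Sq≡ : S q ≡ letter (isEven j)
  Sq≡ = subst (λ n → S n ≡ letter (isEven j)) start+t≡q (runLetter j (<-trans (n<1+n t) t+1<Sj))
  Sq+1≡ : S (suc q) ≡ letter (isEven j)
  Sq+1≡ = subst (λ n → S n ≡ letter (isEven j)) start+t+1≡q+1 (runLetter j t+1<Sj)

runStart-positive : ∀ {n} → 1 ≤ n → 1 ≤ runStart n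
runStart-positive {suc n} _ = ≤-trans (S-pos n) (m≤n+m (S n) (runStart n))

runStart-inflationary : ∀ {n} → 2 ≤ n → n < runStart n
runStart-inflationary (s≤s (s≤s {n = zero} z≤n)) = ≤-refl
runStart-inflationary (s≤s (s≤s {n = suc n} z≤n)) =
  ≤-trans (≤-reflexive (+-comm 1 (3 + n)))
          (+-mono-≤ (runStart-inflationary {suc (suc n)} (s≤s (s≤s z≤n))) (S-pos (suc (suc n))))

iter-runStart-2 : ∀ k → 2 + k ≤ iter k runStart 2
iter-runStart-2 zero    = ≤-refl
iter-runStart-2 (suc k) =
  ≤-trans (s≤s (iter-runStart-2 k)) (runStart-inflationary (≤-trans (m≤m+n 2 k) (iter-runStart-2 k)))

first-index-unique : ∀ {f : ℕ → ℕ} {x y c d} → x ≢ y →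
                     (∀ {t} → t < c → f t ≡ x) → f c ≡ y →
                     (∀ {t} → t < d → f t ≡ x) → f d ≡ y → c ≡ d
first-index-unique {c = c} {d} x≢y below-c at-c below-d at-d with <-cmp c d
... | tri< c<d _ _ = ⊥-elim (x≢y (trans (sym (below-d c<d)) at-c))
... | tri≈ _ c≡d _ = c≡d
... | tri> _ _ d<c = ⊥-elim (x≢y (trans (sym (below-c d<c)) at-d))

runLength : ∀ {c b j rest} → OccursAt (replicate c (letter b) ++ letter (not b) ∷ rest) (runStart j) →
            isEven j ≡ b → c ≡ S j
runLength {c} {b} {j} w-at refl =
  first-index-unique {f = λ t → S (runStart j + t)} (letter≢letter-not b)
    (occursAt-replicate⇒ (proj₁ split))
    (sym (subst (λ n → _ ≡ S (runStart j + n)) (length-replicate c) (∷-injectiveˡ (proj₂ split))))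
    (runLetter j) (trans (cong S (sym (+-identityʳ (runStart (suc j))))) (runLetter (suc j) (S-pos (suc j))))
  where
  split = occursAt-++⁻ (replicate c (letter b)) w-at

parity-occursAt : ∀ {b rest j} → OccursAt (letter b ∷ rest) (runStart j) → isEven j ≡ b
parity-occursAt {b} {j = j} w-at = letter-injective (trans (sym (runLetter j (S-pos j)))
  (trans (cong S (+-identityʳ (runStart j))) (sym (∷-injectiveˡ w-at))))

occursAt-integral⁻ : ∀ {y b j} → Over12 y → OccursAt (integral' b (y ++ 1 ∷ [])) (runStart j) →
                     isEven j ≡ b → OccursAt y j
occursAt-integral⁻ {[]}    _          _    _    = refl
occursAt-integral⁻ {c ∷ y} {b} {j} (_ ∷ y12) w-at refl =
  cong₂ _∷_ c≡Sj (occursAt-integral⁻ {j = suc j} y12 tail-at refl)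
  where
  c≡Sj : c ≡ S j
  c≡Sj with integral'-padded-head (not b) y12
  ... | _ , e = runLength {j = j} (subst (λ v → OccursAt (replicate c (letter b) ++ v) (runStart j)) e w-at) refl
  tail-at : OccursAt (integral' (not b) (y ++ 1 ∷ [])) (runStart (suc j))
  tail-at = subst (OccursAt _) (cong (runStart j +_) (trans (length-replicate c) c≡Sj))
                  (proj₂ (occursAt-++⁻ (replicate c (letter b)) w-at))

occursAt-padded-integral⁻ : ∀ {p Y q} → Over12 Y → OccursAt (integral' p (1 ∷ Y ++ 1 ∷ [])) q →
                            ∃ λ j → runStart j ≡ suc q × isEven j ≡ not p × OccursAt Y j
occursAt-padded-integral⁻ {p} {Y} {q} Y12 w-at with integral'-padded-head (not p) Y12
... | rest , e with subst (λ v → OccursAt (letter p ∷ v) q) e w-at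
...   | w-at′ with run-boundary q (λ Sq≡Sq+1 → letter≢letter-not p
                   (trans (∷-injectiveˡ w-at′) (trans Sq≡Sq+1 (sym (∷-injectiveˡ (∷-injectiveʳ w-at′))))))
...     | j , start≡q+1 = j , start≡q+1 , parity , occursAt-integral⁻ {j = j} Y12 tail-at parity
  where
  tail-at : OccursAt (integral' (not p) (Y ++ 1 ∷ [])) (runStart j)
  tail-at = subst (OccursAt _) (sym start≡q+1) (∷-injectiveʳ w-at)
  parity : isEven j ≡ not p
  parity = parity-occursAt {j = j} (subst (λ v → OccursAt v (runStart j)) e tail-at)

runs'-same : ∀ β c r → runs' (letter β) c (letter β ∷ r) ≡ runs' (letter β) (suc c) r
runs'-same true  c r = refl
runs'-same false c r = refl

runs'-differ : ∀ β c r → runs' (letter β) c (letter (not β) ∷ r) ≡ c ∷ runs' (letter (not β)) 1 r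
runs'-differ true  c r = refl
runs'-differ false c r = refl

runs'-replicate : ∀ β c n r → runs' (letter β) c (replicate n (letter β) ++ r) ≡ runs' (letter β) (c + n) r
runs'-replicate β c zero    r = cong (λ k → runs' (letter β) k r) (sym (+-identityʳ c))
runs'-replicate β c (suc n) r = begin
  runs' (letter β) c (letter β ∷ replicate n (letter β) ++ r) ≡⟨ runs'-same β c (replicate n (letter β) ++ r) ⟩
  runs' (letter β) (suc c) (replicate n (letter β) ++ r)      ≡⟨ runs'-replicate β (suc c) n r ⟩
  runs' (letter β) (suc c + n) r                              ≡⟨ cong (λ k → runs' (letter β) k r) (+-suc c n) ⟨
  runs' (letter β) (c + suc n) r                              ∎
  where open ≡-Reasoning

runs'-integral' : ∀ β c n {y} → Over12 y →
                  runs' (letter β) c (replicate n (letter β) ++ integral' (not β) y) ≡ (c + n) ∷ y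
runs'-integral' β c n [] = runs'-replicate β c n []
runs'-integral' β c n {suc d ∷ y} (_ ∷ y12) = begin
  runs' (letter β) c (replicate n (letter β) ++ letter (not β) ∷ rest)
    ≡⟨ runs'-replicate β c n (letter (not β) ∷ rest) ⟩
  runs' (letter β) (c + n) (letter (not β) ∷ rest)
    ≡⟨ runs'-differ β (c + n) rest ⟩
  (c + n) ∷ runs' (letter (not β)) 1 rest
    ≡⟨ cong ((c + n) ∷_) (runs'-integral' (not β) 1 d y12) ⟩
  (c + n) ∷ suc d ∷ y ∎
  where
  open ≡-Reasoning
  rest = replicate d (letter (not β)) ++ integral' (not (not β)) y
runs'-integral' β c n {zero ∷ y} (inj₁ () ∷ _)
runs'-integral' β c n {zero ∷ y} (inj₂ () ∷ _)

runs-integral' : ∀ β {c y} → Is12 c → Over12 y → runs (integral' β (c ∷ y)) ≡ c ∷ y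
runs-integral' β (inj₁ refl) y12 = runs'-integral' β 1 0 y12
runs-integral' β (inj₂ refl) y12 = runs'-integral' β 1 1 y12

integral'-runs' : ∀ β c {r} → Over12 r → integral' β (runs' (letter β) c r) ≡ replicate c (letter β) ++ r
integral'-runs' β c [] = refl
integral'-runs' β c {a ∷ r} (a12 ∷ r12) with letter-or-not β a12
... | inj₁ refl = begin
  integral' β (runs' (letter β) c (letter β ∷ r))  ≡⟨ cong (integral' β) (runs'-same β c r) ⟩
  integral' β (runs' (letter β) (suc c) r)         ≡⟨ integral'-runs' β (suc c) r12 ⟩
  replicate (suc c) (letter β) ++ r                ≡⟨ replicate-suc-++ c (letter β) r ⟩
  replicate c (letter β) ++ letter β ∷ r           ∎
  where open ≡-Reasoning
... | inj₂ refl = begin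
  integral' β (runs' (letter β) c (letter (not β) ∷ r))
    ≡⟨ cong (integral' β) (runs'-differ β c r) ⟩
  replicate c (letter β) ++ integral' (not β) (runs' (letter (not β)) 1 r)
    ≡⟨ cong (replicate c (letter β) ++_) (integral'-runs' (not β) 1 r12) ⟩
  replicate c (letter β) ++ letter (not β) ∷ r ∎
  where open ≡-Reasoning

length-runs' : ∀ a c r → length (runs' a c r) ≤ suc (length r)
length-runs' a c []      = ≤-refl
length-runs' a c (b ∷ r) with a ≡ᵇ b
... | true  = m≤n⇒m≤1+n (length-runs' a (suc c) r)
... | false = s≤s (length-runs' b 1 r)

length-runs : ∀ u → length (runs u) ≤ length u
length-runs []      = z≤n
length-runs (a ∷ u) = length-runs' a 1 u

runs'-nonempty : ∀ a c r → ∃ λ d → ∃ λ D → runs' a c r ≡ d ∷ D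
runs'-nonempty a c []      = c , [] , refl
runs'-nonempty a c (b ∷ r) with a ≡ᵇ b
... | true  = runs'-nonempty a (suc c) r
... | false = c , runs' b 1 r , refl

trimL-same : ∀ a r → trimL (a ∷ a ∷ r) ≡ a ∷ a ∷ r
trimL-same a r with a ≡ᵇ a in eq
... | true  = refl
... | false = ⊥-elim (subst T eq (≡⇒≡ᵇ a a refl))

trimL-differ : ∀ {a b} r → a ≢ b → trimL (a ∷ b ∷ r) ≡ b ∷ r
trimL-differ {a} {b} r a≢b with a ≡ᵇ b in eq
... | true  = ⊥-elim (a≢b (≡ᵇ⇒≡ a b (subst T (sym eq) tt)))
... | false = refl

trimR-same : ∀ X a → trimR (X ++ a ∷ a ∷ []) ≡ X ++ a ∷ a ∷ []
trimR-same X a = begin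
  reverse (trimL (reverse (X ++ a ∷ a ∷ [])))  ≡⟨ cong (reverse ∘ trimL) (reverse-++ X (a ∷ a ∷ [])) ⟩
  reverse (trimL (a ∷ a ∷ reverse X))          ≡⟨ cong reverse (trimL-same a (reverse X)) ⟩
  reverse (a ∷ a ∷ reverse X)                  ≡⟨ cong reverse (reverse-++ X (a ∷ a ∷ [])) ⟨
  reverse (reverse (X ++ a ∷ a ∷ []))          ≡⟨ reverse-involutive _ ⟩
  X ++ a ∷ a ∷ []                              ∎
  where open ≡-Reasoning

trimR-differ : ∀ X {a b} → a ≢ b → trimR (X ++ a ∷ b ∷ []) ≡ X ++ a ∷ []
trimR-differ X {a} {b} a≢b = begin
  reverse (trimL (reverse (X ++ a ∷ b ∷ [])))  ≡⟨ cong (reverse ∘ trimL) (reverse-++ X (a ∷ b ∷ [])) ⟩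
  reverse (trimL (b ∷ a ∷ reverse X))          ≡⟨ cong reverse (trimL-differ (reverse X) (a≢b ∘ sym)) ⟩
  reverse (a ∷ reverse X)                      ≡⟨ cong reverse (reverse-++ X (a ∷ [])) ⟨
  reverse (reverse (X ++ a ∷ []))              ≡⟨ reverse-involutive _ ⟩
  X ++ a ∷ []                                  ∎
  where open ≡-Reasoning

snoc-view : ∀ (v : Word) → 2 ≤ length v → ∃ λ X → ∃ λ z → ∃ λ x → v ≡ X ++ z ∷ x ∷ []
snoc-view (a ∷ [])        (s≤s ())
snoc-view (a ∷ b ∷ [])    _ = [] , a , b , refl
snoc-view (a ∷ b ∷ c ∷ v) _ with snoc-view (b ∷ c ∷ v) (s≤s (s≤s z≤n))
... | X , z , x , e = a ∷ X , z , x , cong (a ∷_) e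

record LeftTrim (w : Word) : Set where
  field
    β    : Bool
    e    : ℕ
    e≤1  : e ≤ 1
    rest : Word
    trimL≡ : trimL w ≡ letter β ∷ rest
    w≡     : w ≡ replicate e (letter (not β)) ++ trimL w

leftTrim : ∀ {a b} r → Is12 a → Is12 b → LeftTrim (a ∷ b ∷ r)
leftTrim {a} r a12 b12 with is12⇒letter b12
... | β , refl with letter-or-not β a12
...   | inj₁ refl = record { β = β ; e = 0 ; e≤1 = z≤n ; rest = letter β ∷ r
                           ; trimL≡ = trimL-same (letter β) r ; w≡ = sym (trimL-same (letter β) r) }
...   | inj₂ refl = record { β = β ; e = 1 ; e≤1 = ≤-refl ; rest = r
                           ; trimL≡ = differ ; w≡ = cong (letter (not β) ∷_) (sym differ) }
  where
  differ : trimL (letter (not β) ∷ letter β ∷ r) ≡ letter β ∷ r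
  differ = trimL-differ r (letter≢letter-not β ∘ sym)

record RightTrim (v : Word) : Set where
  field
    γ    : Bool
    e    : ℕ
    e≤1  : e ≤ 1
    init : Word
    trimR≡ : trimR v ≡ init ++ letter γ ∷ []
    v≡     : v ≡ trimR v ++ replicate e (letter (not γ))

rightTrim : ∀ v → 2 ≤ length v → Over12 v → RightTrim v
rightTrim v 2≤v v12 with snoc-view v 2≤v
... | X , z , x , refl with ++⁻ʳ X v12
...   | z12 ∷ x12 ∷ [] with is12⇒letter z12
...     | γ , refl with letter-or-not γ x12
...       | inj₁ refl = record { γ = γ ; e = 0 ; e≤1 = z≤n ; init = X ++ letter γ ∷ []
                               ; trimR≡ = trans (trimR-same X (letter γ)) (sym (++-assoc X _ _))
                               ; v≡ = sym (trans (++-identityʳ _) (trimR-same X (letter γ))) }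
...       | inj₂ refl = record { γ = γ ; e = 1 ; e≤1 = ≤-refl ; init = X ; trimR≡ = differ
                               ; v≡ = trans (sym (++-assoc X _ _))
                                            (cong (_++ letter (not γ) ∷ []) (sym differ)) }
  where
  differ : trimR (X ++ letter γ ∷ letter (not γ) ∷ []) ≡ X ++ letter γ ∷ []
  differ = trimR-differ X (letter≢letter-not γ)

runs-untrimmed-shorter : ∀ a b r → trimL (a ∷ b ∷ r) ≡ a ∷ b ∷ r →
                         length (runs (a ∷ b ∷ r)) < 2 + length r
runs-untrimmed-shorter a b r untrimmed with a ≡ᵇ b
... | true  = s≤s (length-runs' a 2 r)
... | false = ⊥-elim (<⇒≢ (n<1+n _) (cong length untrimmed))

length-padded : ∀ m n (x y : ℕ) u → length (replicate m x ++ u ++ replicate n y) ≡ m + (length u + n)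
length-padded m n x y u = begin
  length (replicate m x ++ u ++ replicate n y)             ≡⟨ length-++ (replicate m x) ⟩
  length (replicate m x) + length (u ++ replicate n y)    ≡⟨ cong₂ _+_ (length-replicate m) (length-++ u) ⟩
  m + (length u + length (replicate n y))
    ≡⟨ cong (λ k → m + (length u + k)) (length-replicate n) ⟩
  m + (length u + n)                                      ∎
  where open ≡-Reasoning

runs-core-shorter : ∀ {a b r e₁ e₂ x y} u → e₁ ≤ 1 → e₂ ≤ 1 →
                    a ∷ b ∷ r ≡ replicate e₁ x ++ u ++ replicate e₂ y →
                    trimL (a ∷ b ∷ r) ≡ u ++ replicate e₂ y →
                    length (runs u) < length (a ∷ b ∷ r)
runs-core-shorter {a} {b} {r} u z≤n z≤n w≡ trimL≡ =
  subst (λ v → length (runs v) < 2 + length r) w≡u (runs-untrimmed-shorter a b r (trans trimL≡ (sym w≡)))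
  where
  w≡u : a ∷ b ∷ r ≡ u
  w≡u = trans w≡ (++-identityʳ u)
runs-core-shorter {e₂ = e₂} {x} {y} u (s≤s z≤n) _ w≡ _ =
  subst (length (runs u) <_) (sym (trans (cong length w≡) (length-padded 1 e₂ x y u)))
        (s≤s (≤-trans (length-runs u) (m≤m+n (length u) e₂)))
runs-core-shorter {x = x} {y} u z≤n (s≤s z≤n) w≡ _ =
  subst (length (runs u) <_) (sym (trans (cong length w≡) (length-padded 0 1 x y u)))
        (≤-trans (s≤s (length-runs u)) (≤-reflexive (+-comm 1 (length u))))

head-of-prefix : ∀ {u t : Word} {a s X z} → u ++ t ≡ a ∷ s → u ≡ X ++ z ∷ [] →
                 ∃ λ u′ → u ≡ a ∷ u′
head-of-prefix {[]}    {X = []}    _ ()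
head-of-prefix {[]}    {X = _ ∷ _} _ ()
head-of-prefix {c ∷ u} e _ = u , cong (_∷ u) (∷-injectiveˡ e)

record Trimmed (w : Word) : Set where
  field
    β γ       : Bool
    e₁ e₂     : ℕ
    e₁≤1      : e₁ ≤ 1
    e₂≤1      : e₂ ≤ 1
    core′ init : Word
    core≡ˡ    : trimR (trimL w) ≡ letter β ∷ core′
    core≡ʳ    : trimR (trimL w) ≡ init ++ letter γ ∷ []
    w≡        : w ≡ replicate e₁ (letter (not β)) ++ trimR (trimL w) ++ replicate e₂ (letter (not γ))
    shorter   : length (runs (trimR (trimL w))) < length w

trimmed : ∀ {a b c} r → Over12 (a ∷ b ∷ c ∷ r) → Trimmed (a ∷ b ∷ c ∷ r)
trimmed {a} {b} {c} r w12@(a12 ∷ b12 ∷ _) = record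
  { β = L.β ; γ = R.γ ; e₁ = L.e ; e₂ = R.e ; e₁≤1 = L.e≤1 ; e₂≤1 = R.e≤1
  ; core′ = proj₁ core-head ; init = R.init ; core≡ˡ = proj₂ core-head ; core≡ʳ = R.trimR≡
  ; w≡ = w≡ ; shorter = runs-core-shorter (trimR v) L.e≤1 R.e≤1 w≡ R.v≡ }
  where
  L = leftTrim (c ∷ r) a12 b12
  module L = LeftTrim L
  v = trimL (a ∷ b ∷ c ∷ r)
  v12 : Over12 v
  v12 = ++⁻ʳ (replicate L.e _) (subst Over12 L.w≡ w12)
  2≤v : 2 ≤ length v
  2≤v = ≤-pred (begin
    3                                                 ≤⟨ s≤s (s≤s (s≤s z≤n)) ⟩
    length (a ∷ b ∷ c ∷ r)                            ≡⟨ cong length L.w≡ ⟩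
    length (replicate L.e (letter (not L.β)) ++ v)    ≡⟨ length-++ (replicate L.e _) ⟩
    length (replicate L.e (letter (not L.β))) + length v ≡⟨ cong (_+ length v) (length-replicate L.e) ⟩
    L.e + length v                                    ≤⟨ +-monoˡ-≤ (length v) L.e≤1 ⟩
    1 + length v                                      ∎)
    where open ≤-Reasoning
  module R = RightTrim (rightTrim v 2≤v v12)
  core-head : ∃ λ u′ → trimR v ≡ letter L.β ∷ u′
  core-head = head-of-prefix (trans (sym R.v≡) L.trimL≡) R.trimR≡
  w≡ : a ∷ b ∷ c ∷ r ≡ replicate L.e (letter (not L.β)) ++ trimR v ++ replicate R.e (letter (not R.γ))
  w≡ = trans L.w≡ (cong (replicate L.e (letter (not L.β)) ++_) R.v≡)

integral'-padded-runs : ∀ {β γ u′ X} b c → Over12 u′ → Over12 (runs (letter β ∷ u′)) →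
                        letter β ∷ u′ ≡ X ++ letter γ ∷ [] →
                        integral' (not β) (b ∷ runs (letter β ∷ u′) ++ c ∷ []) ≡
                        replicate b (letter (not β)) ++ (letter β ∷ u′) ++ replicate c (letter (not γ))
integral'-padded-runs {β} {γ} {u′} {X} b c u′12 R12 ends-γ with runs'-nonempty (letter β) 1 u′
... | d , D , R≡ with subst Over12 R≡ R12
...   | d12 ∷ D12 = cong (replicate b (letter (not β)) ++_) (begin
  integral' (not (not β)) (R ++ c ∷ [])
    ≡⟨ cong (λ b′ → integral' b′ (R ++ c ∷ [])) (not-involutive β) ⟩
  integral' β (R ++ c ∷ [])
    ≡⟨ cong (λ v → integral' β (v ++ c ∷ [])) R≡ ⟩
  integral' β ((d ∷ D) ++ c ∷ [])
    ≡⟨ integral'-snoc β {X = X} c d12 D12 (trans dD≡u ends-γ) ⟩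
  integral' β (d ∷ D) ++ replicate c (letter (not γ))
    ≡⟨ cong (_++ replicate c (letter (not γ))) dD≡u ⟩
  (letter β ∷ u′) ++ replicate c (letter (not γ)) ∎)
  where
  open ≡-Reasoning
  R = runs (letter β ∷ u′)
  dD≡u : integral' β (d ∷ D) ≡ letter β ∷ u′
  dD≡u = trans (cong (integral' β) (sym R≡)) (integral'-runs' β 1 u′12)

padding-infix : ∀ {e₁ e₂ m n} (x y : ℕ) u → e₁ ≤ m → e₂ ≤ n →
                replicate m x ++ u ++ replicate n y ≡
                replicate (m ∸ e₁) x ++ (replicate e₁ x ++ u ++ replicate e₂ y) ++ replicate (n ∸ e₂) y
padding-infix {e₁} {e₂} {m} {n} x y u e₁≤m e₂≤n = begin
  replicate m x ++ u ++ replicate n y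
    ≡⟨ cong₂ (λ k l → replicate k x ++ u ++ replicate l y) (m∸n+n≡m e₁≤m) (m+[n∸m]≡n e₂≤n) ⟨
  replicate (m ∸ e₁ + e₁) x ++ u ++ replicate (e₂ + (n ∸ e₂)) y
    ≡⟨ cong₂ (λ A D → A ++ u ++ D) (replicate-+ (m ∸ e₁) e₁ x) (replicate-+ e₂ (n ∸ e₂) y) ⟩
  (A ++ B) ++ u ++ C ++ D       ≡⟨ ++-assoc A B (u ++ C ++ D) ⟩
  A ++ B ++ u ++ C ++ D         ≡⟨ cong (λ v → A ++ B ++ v) (++-assoc u C D) ⟨
  A ++ B ++ (u ++ C) ++ D       ≡⟨ cong (A ++_) (++-assoc B (u ++ C) D) ⟨
  A ++ (B ++ u ++ C) ++ D       ∎
  where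
  open ≡-Reasoning
  A = replicate (m ∸ e₁) x
  B = replicate e₁ x
  C = replicate e₂ y
  D = replicate (n ∸ e₂) y

infix-integral-deriv : ∀ {a b c r} → Over12 (a ∷ b ∷ c ∷ r) → Over12 (deriv (a ∷ b ∷ c ∷ r)) →
                       ∃ λ p → ∀ {b₀ c₀} → 1 ≤ b₀ → 1 ≤ c₀ → ∃ λ l → ∃ λ l′ →
                         integral' p (b₀ ∷ deriv (a ∷ b ∷ c ∷ r) ++ c₀ ∷ []) ≡ l ++ (a ∷ b ∷ c ∷ r) ++ l′
infix-integral-deriv {a} {b} {c} {r} w12 D12 = not β , expand
  where
  open ≡-Reasoning
  open Trimmed (trimmed r w12)
  u = trimR (trimL (a ∷ b ∷ c ∷ r))
  core′12 : Over12 core′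
  core′12 with subst Over12 core≡ˡ (++⁻ˡ u (++⁻ʳ (replicate e₁ _) (subst Over12 w≡ w12)))
  ... | _ ∷ core′12 = core′12
  expand : ∀ {b₀ c₀} → 1 ≤ b₀ → 1 ≤ c₀ → ∃ λ l → ∃ λ l′ →
           integral' (not β) (b₀ ∷ runs u ++ c₀ ∷ []) ≡ l ++ (a ∷ b ∷ c ∷ r) ++ l′
  expand {b₀} {c₀} 1≤b₀ 1≤c₀ = L , L′ , (begin
    integral' (not β) (b₀ ∷ runs u ++ c₀ ∷ [])
      ≡⟨ cong (λ v → integral' (not β) (b₀ ∷ runs v ++ c₀ ∷ [])) core≡ˡ ⟩
    integral' (not β) (b₀ ∷ runs (letter β ∷ core′) ++ c₀ ∷ [])
      ≡⟨ integral'-padded-runs b₀ c₀ core′12 (subst (Over12 ∘ runs) core≡ˡ D12) (trans (sym core≡ˡ) core≡ʳ) ⟩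
    replicate b₀ (letter (not β)) ++ (letter β ∷ core′) ++ replicate c₀ (letter (not γ))
      ≡⟨ cong (λ v → replicate b₀ (letter (not β)) ++ v ++ replicate c₀ (letter (not γ))) core≡ˡ ⟨
    replicate b₀ (letter (not β)) ++ u ++ replicate c₀ (letter (not γ))
      ≡⟨ padding-infix _ _ u (≤-trans e₁≤1 1≤b₀) (≤-trans e₂≤1 1≤c₀) ⟩
    L ++ (replicate e₁ (letter (not β)) ++ u ++ replicate e₂ (letter (not γ))) ++ L′
      ≡⟨ cong (λ v → L ++ v ++ L′) w≡ ⟨
    L ++ (a ∷ b ∷ c ∷ r) ++ L′ ∎)
    where
    L = replicate (b₀ ∸ e₁) (letter (not β))
    L′ = replicate (c₀ ∸ e₂) (letter (not γ))

deriv-∷ : ∀ a v → 2 ≤ length v → deriv (a ∷ v) ≡ runs (trimR (trimL (a ∷ v)))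
deriv-∷ a (b ∷ [])     (s≤s ())
deriv-∷ a (b ∷ c ∷ r)  _ = refl

deriv-padded-integral : ∀ p {y Y} → Is12 y → Over12 Y →
                        deriv (integral' p (1 ∷ (y ∷ Y) ++ 1 ∷ [])) ≡ y ∷ Y
deriv-padded-integral p {y} {Y} y12 Y12
  with integral'-last (not p) y12 Y12 | integral'-padded-head (not p) (y12 ∷ Y12)
... | X , V≡ | rest , W≡ = begin
  deriv (letter p ∷ W)                        ≡⟨ deriv-∷ (letter p) W 2≤W ⟩
  runs (trimR (trimL (letter p ∷ W)))         ≡⟨ cong (λ v → runs (trimR (trimL (letter p ∷ v)))) W≡ ⟩
  runs (trimR (trimL (letter p ∷ letter (not p) ∷ rest)))
    ≡⟨ cong (λ v → runs (trimR v)) (trimL-differ rest (letter≢letter-not p)) ⟩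
  runs (trimR (letter (not p) ∷ rest))        ≡⟨ cong (λ v → runs (trimR v)) (trans (sym W≡) W≡Xγγ) ⟩
  runs (trimR (X ++ letter γ ∷ letter (not γ) ∷ []))
    ≡⟨ cong runs (trimR-differ X (letter≢letter-not γ)) ⟩
  runs (X ++ letter γ ∷ [])                   ≡⟨ cong runs V≡ ⟨
  runs (integral' (not p) (y ∷ Y))            ≡⟨ runs-integral' (not p) y12 Y12 ⟩
  y ∷ Y                                       ∎
  where
  open ≡-Reasoning
  γ = iter (length Y) not (not p)
  W = integral' (not p) ((y ∷ Y) ++ 1 ∷ [])
  W≡Xγγ : W ≡ X ++ letter γ ∷ letter (not γ) ∷ []
  W≡Xγγ = trans (integral'-snoc (not p) 1 y12 Y12 V≡)
                (trans (cong (_++ letter (not γ) ∷ []) V≡) (++-assoc X _ _))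
  2≤W : 2 ≤ length W
  2≤W = subst (λ v → 2 ≤ length v) (sym W≡Xγγ)
              (subst (2 ≤_) (sym (length-++ X)) (m≤n+m 2 (length X)))

cinf-[] : Cinf []
cinf-[] zero    = []
cinf-[] (suc k) = subst Over12 (sym (trans (iter-shift k deriv []) (cinf-[]-iter k))) []
  where
  cinf-[]-iter : ∀ k → iter k deriv [] ≡ []
  cinf-[]-iter zero    = refl
  cinf-[]-iter (suc k) = cong deriv (cinf-[]-iter k)

cinf-deriv : ∀ {w} → Cinf w → Cinf (deriv w)
cinf-deriv {w} w∞ k = subst Over12 (iter-shift k deriv w) (w∞ (suc k))

cinf-deriv⁻ : ∀ {w} → Over12 w → Cinf (deriv w) → Cinf w
cinf-deriv⁻ w12 w′∞ zero    = w12
cinf-deriv⁻ {w} w12 w′∞ (suc k) = subst Over12 (sym (iter-shift k deriv w)) (w′∞ k)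

-- Normal prefixes from C∞ subwords

HasParities : (ℕ → Bool) → ℕ → ℕ → Set
HasParities τ h m = ∀ t → t < h → isEven (iter t runStart m) ≡ τ t

regular-prefix : ∀ {k m} → (∀ h → h ≤ k → isEven (iter h runStart m) ≡ true) → Regular k (prefix m)
regular-prefix {m = m} even h h≤k =
  subst (2 ∣_) (sym (length-integralPow-prefix h m)) (isEven⇒2∣ _ (even h h≤k))

regular-prefix⁻ : ∀ {k m} → Regular k (prefix m) → ∀ h → h ≤ k → isEven (iter h runStart m) ≡ true
regular-prefix⁻ {m = m} reg h h≤k =
  2∣⇒isEven _ (subst (2 ∣_) (length-integralPow-prefix h m) (reg h h≤k))

normal-prefix : ∀ k m → HasParities (λ t → does (t ≤? k)) (2 + k) m → Normal k (prefix m)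
normal-prefix k m parities = regular-prefix even , not-regular
  where
  even : ∀ h → h ≤ k → isEven (iter h runStart m) ≡ true
  even h h≤k = trans (parities h (s≤s (m≤n⇒m≤1+n h≤k))) (dec-true (h ≤? k) h≤k)
  not-regular : ¬ Regular (suc k) (prefix m)
  not-regular reg = true≢false (trans (sym (regular-prefix⁻ reg (suc k) ≤-refl))
                                     (trans (parities (suc k) ≤-refl) (dec-false (suc k ≤? k) (<-irrefl refl))))
    where
    true≢false : true ≢ false
    true≢false ()

-- towerCore τ h is the part of tower τ h preceding the h-fold integral of its bottom
-- letter; when tower τ (suc h) occurs in S, towerFlag τ h forces the position of that
-- integral in the underlying occurrence of tower τ h to have parity τ h.
towerFlag : (ℕ → Bool) → ℕ → Bool
towerCore : (ℕ → Bool) → ℕ → Word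

towerFlag τ h = τ h xor isEven (length (towerCore τ h))

towerCore τ zero    = []
towerCore τ (suc h) = integral' (towerFlag τ h) (1 ∷ towerCore τ h)

tower : (ℕ → Bool) → ℕ → Word
tower τ zero    = 1 ∷ []
tower τ (suc h) = integral' (towerFlag τ h) (1 ∷ tower τ h ++ 1 ∷ [])

tower-∷ : ∀ τ h → ∃ λ y → ∃ λ Y → tower τ h ≡ y ∷ Y × Is12 y × Over12 Y
tower-∷ τ zero    = 1 , [] , refl , inj₁ refl , []
tower-∷ τ (suc h) = _ , _ , refl , letter-is12 _ , over12-integral' _ (tower τ h ++ 1 ∷ [])

over12-tower : ∀ τ h → Over12 (tower τ h)
over12-tower τ h with tower-∷ τ h
... | y , Y , e , y12 , Y12 = subst Over12 (sym e) (y12 ∷ Y12)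

deriv-tower : ∀ τ h → deriv (tower τ (suc h)) ≡ tower τ h
deriv-tower τ h with tower-∷ τ h
... | y , Y , e , y12 , Y12 =
  trans (cong (λ v → deriv (integral' (towerFlag τ h) (1 ∷ v ++ 1 ∷ []))) e)
        (trans (deriv-padded-integral (towerFlag τ h) y12 Y12) (sym e))

cinf-tower : ∀ τ h → Cinf (tower τ h)
cinf-tower τ zero    = cinf-deriv⁻ (inj₁ refl ∷ []) cinf-[]
cinf-tower τ (suc h) =
  cinf-deriv⁻ (over12-tower τ (suc h)) (subst Cinf (sym (deriv-tower τ h)) (cinf-tower τ h))

towerCore≼tower : ∀ τ h → towerCore τ h ≼ tower τ h
towerCore≼tower τ zero    = 1 ∷ [] , refl
towerCore≼tower τ (suc h) with towerCore≼tower τ h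
... | t , e = integral'-≼ (towerFlag τ h) {1 ∷ towerCore τ h} {1 ∷ tower τ h ++ 1 ∷ []}
                (t ++ 1 ∷ [] , cong (1 ∷_) (trans (cong (_++ 1 ∷ []) e) (++-assoc (towerCore τ h) t _)))

tower-parities : ∀ τ h {q} → OccursAt (tower τ h) q →
                 ∃ λ c₀ → HasParities τ h c₀ × iter h runStart c₀ ≡ q + length (towerCore τ h)
tower-parities τ zero    {q} _ = q , (λ _ ()) , sym (+-identityʳ q)
tower-parities τ (suc h) {q} occ =
  lift (occursAt-padded-integral⁻ {towerFlag τ h} {tower τ h} {q} (over12-tower τ h) occ)
  where
  open ≡-Reasoning
  P = towerCore τ h
  lift : (∃ λ j → runStart j ≡ suc q × isEven j ≡ not (towerFlag τ h) × OccursAt (tower τ h) j) →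
         ∃ λ c₀ → HasParities τ (suc h) c₀ × iter (suc h) runStart c₀ ≡ q + length (towerCore τ (suc h))
  lift (j , start≡q+1 , parity-j , tower-at-j) = extend (tower-parities τ h tower-at-j)
    where
    P-at-j : OccursAt P j
    P-at-j = proj₁ (occursAt-++⁻ P (subst (λ v → OccursAt v j) (proj₂ (towerCore≼tower τ h)) tower-at-j))
    extend : (∃ λ c₀ → HasParities τ h c₀ × iter h runStart c₀ ≡ j + length P) →
             ∃ λ c₀ → HasParities τ (suc h) c₀ × iter (suc h) runStart c₀ ≡ q + length (towerCore τ (suc h))
    extend (c₀ , parities , iter≡) = c₀ , parities′ , iter≡′
      where
      iter≡′ : runStart (iter h runStart c₀) ≡ q + length (towerCore τ (suc h))
      iter≡′ = begin
        runStart (iter h runStart c₀)    ≡⟨ cong runStart iter≡ ⟩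
        runStart (j + length P)          ≡⟨ runStart-occursAt P-at-j ⟩
        runStart j + sum P               ≡⟨ cong (_+ sum P) start≡q+1 ⟩
        suc q + sum P                    ≡⟨ +-suc q (sum P) ⟨
        q + (1 + sum P)                  ≡⟨ cong (q +_) (length-integral' (towerFlag τ h) (1 ∷ P)) ⟨
        q + length (towerCore τ (suc h)) ∎
      parity-h : isEven (iter h runStart c₀) ≡ τ h
      parity-h = trans (cong isEven iter≡) (isEven-+-xor j (length P) (τ h) parity-j)
      parities′ : HasParities τ (suc h) c₀
      parities′ t t<h+1 with m<1+n⇒m<n∨m≡n t<h+1
      ... | inj₁ t<h  = parities t t<h
      ... | inj₂ refl = parity-h

normal-prefix-exists : ((w : Word) → Cinf w → SubwordOfS w) → ∀ k → ∃ λ m → Normal k (prefix m)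
normal-prefix-exists all-subwords k =
  from-occurrence (subwordOfS⇒occurs (all-subwords (tower τ (2 + k)) (cinf-tower τ (2 + k))))
  where
  τ : ℕ → Bool
  τ t = does (t ≤? k)
  from-occurrence : Occurs (tower τ (2 + k)) → ∃ λ m → Normal k (prefix m)
  from-occurrence (i , tower-at-i) = m , normal-prefix k m (proj₁ (proj₂ found))
    where
    found = tower-parities τ (2 + k) tower-at-i
    m = proj₁ found

-- C∞ subwords from normal prefixes

normal-parities : ∀ {k m} → Normal k (prefix m) →
                  (∀ h → h ≤ k → isEven (iter h runStart m) ≡ true) ×
                  isEven (iter (suc k) runStart m) ≡ false
normal-parities {k} {m} (regular , not-regular) =
  even , ¬-not (λ next-even → not-regular (regular-prefix (even-up-to-suc next-even)))
  where
  even : ∀ h → h ≤ k → isEven (iter h runStart m) ≡ true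
  even = regular-prefix⁻ regular
  even-up-to-suc : isEven (iter (suc k) runStart m) ≡ true →
                   ∀ h → h ≤ suc k → isEven (iter h runStart m) ≡ true
  even-up-to-suc next-even h h≤k+1 with m≤n⇒m<n∨m≡n h≤k+1
  ... | inj₁ h<k+1 = even h (≤-pred h<k+1)
  ... | inj₂ refl  = next-even

-- The first k+1 integrals of S m ∷ S (suc m) ∷ [] are taken at even positions, where
-- integral' agrees with integral; the next one is taken at an odd position.
complement-prefix-occursAt : ∀ {k m} → Normal k (prefix m) →
                             OccursAt (complement (prefix (iter k runStart 2))) (iter (2 + k) runStart m)
complement-prefix-occursAt {k} {m} normal =
  proj₁ (occursAt-++⁻ (complement (prefix A)) (subst (λ v → OccursAt v L) split Y-at))
  where
  A = iter k runStart 2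
  L = iter (2 + k) runStart m
  x₀ = S m ∷ S (suc m) ∷ []
  parities = normal-parities normal
  X-at : OccursAt (integralPow (suc k) x₀) (iter (suc k) runStart m)
  X-at = occursAt-integralPow (suc k) {x₀} refl (λ t t<k+1 → proj₁ parities t (≤-pred t<k+1))
  Y-at : OccursAt (integral' false (integralPow (suc k) x₀)) L
  Y-at = subst (λ b → OccursAt (integral' b (integralPow (suc k) x₀)) L)
               (proj₂ parities) (occursAt-integral X-at)
  A≼ : prefix A ≼ integralPow (2 + k) x₀
  A≼ = subst (prefix A ≼_)
             (sym (trans (cong (λ n → integralPow n x₀) (+-comm 2 k)) (iter-+ k 2 integral x₀)))
             (integralPow-prefix-≼ k (prefix2≼integralPow2 (S-is12 m) (S-is12 (suc m))))
  split : integral' false (integralPow (suc k) x₀) ≡ complement (prefix A) ++ complement (proj₁ A≼)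
  split = trans (integral'-not true (integralPow (suc k) x₀))
                (trans (cong complement (proj₂ A≼)) (map-++ compl (prefix A) (proj₁ A≼)))

ArbitrarilyNormal : Set
ArbitrarilyNormal = (n : ℕ) → 1 ≤ n → ∃ λ k → n < k × ∃ λ m → Normal k (prefix m)

complement-occursInside : ArbitrarilyNormal → ∀ {u i} → OccursAt u i → OccursInside (complement u)
complement-occursInside normals {u} {i} u-at = from-normal (normals (suc (i + length u)) (s≤s z≤n))
  where
  from-normal : (∃ λ k → suc (i + length u) < k × ∃ λ m → Normal k (prefix m)) → OccursInside (complement u)
  from-normal (k , i+u<k , m , normal) =
    L ∸ 1 + i , subst (OccursAt (complement u)) (cong (_+ i) (sym (m+[n∸m]≡n 1≤L)))
                      (complement-prefix-occursAt⇒ (complement-prefix-occursAt {k} {m} normal) u-at i+u≤A)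
    where
    L = iter (2 + k) runStart m
    1≤L : 1 ≤ L
    1≤L = runStart-positive {iter (suc k) runStart m} (odd⇒positive (proj₂ (normal-parities {k} {m} normal)))
    i+u≤A : i + length u ≤ iter k runStart 2
    i+u≤A = ≤-trans (<⇒≤ (<-trans (n<1+n _) i+u<k)) (≤-trans (m≤n+m k 2) (iter-runStart-2 k))

occursInside : ArbitrarilyNormal → ∀ {w} → Over12 w → Occurs w ⊎ Occurs (complement w) → OccursInside w
occursInside normals {w} w12 occurs =
  subst OccursInside (complement-involutive w12)
        (complement-occursInside normals (proj₂ (complement-occurs occurs)))
  where
  complement-occurs : Occurs w ⊎ Occurs (complement w) → Occurs (complement w)
  complement-occurs (inj₁ (_ , w-at)) = _ , proj₂ (complement-occursInside normals w-at)
  complement-occurs (inj₂ cw-occurs)  = cw-occurs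

short-occurs : ∀ {w} → Over12 w → length w ≤ 2 → Occurs w
short-occurs []                            _ = 0 , refl
short-occurs (inj₁ refl ∷ [])              _ = 0 , refl
short-occurs (inj₂ refl ∷ [])              _ = 1 , refl
short-occurs (inj₁ refl ∷ inj₁ refl ∷ [])  _ = 3 , refl
short-occurs (inj₁ refl ∷ inj₂ refl ∷ [])  _ = 0 , refl
short-occurs (inj₂ refl ∷ inj₁ refl ∷ [])  _ = 2 , refl
short-occurs (inj₂ refl ∷ inj₂ refl ∷ [])  _ = 1 , refl
short-occurs (_ ∷ _ ∷ _ ∷ _)               (s≤s (s≤s ()))

-- The occurrence of the derivative must avoid position 0, so that it can be padded
-- by the letter of S preceding it.
occurs-from-deriv : ∀ {a b c r} → Over12 (a ∷ b ∷ c ∷ r) → Over12 (deriv (a ∷ b ∷ c ∷ r)) →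
                    OccursInside (deriv (a ∷ b ∷ c ∷ r)) →
                    Occurs (a ∷ b ∷ c ∷ r) ⊎ Occurs (complement (a ∷ b ∷ c ∷ r))
occurs-from-deriv {a} {b} {c} {r} w12 D12 (i , D-at) = by-parity (isEven i ≟ᵇ p)
  where
  w = a ∷ b ∷ c ∷ r
  D = deriv w
  V = S i ∷ D ++ S (suc i + length D) ∷ []
  V-at : OccursAt V i
  V-at = cong (S i ∷_) (occursAt-++ D-at refl)
  p = proj₁ (infix-integral-deriv w12 D12)
  embedding = proj₂ (infix-integral-deriv w12 D12) (S-pos i) (S-pos (suc i + length D))
  l = proj₁ embedding
  l′ = proj₁ (proj₂ embedding)
  V≡ : integral' p V ≡ l ++ w ++ l′
  V≡ = proj₂ (proj₂ embedding)
  at-runStart : ∀ {v} → integral' (isEven i) V ≡ v → OccursAt v (runStart i)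
  at-runStart e = subst (λ v → OccursAt v (runStart i)) e (occursAt-integral V-at)
  by-parity : Dec (isEven i ≡ p) → Occurs w ⊎ Occurs (complement w)
  by-parity (yes e) = inj₁ (_ , occursAt-infix l (at-runStart (trans (cong (λ b → integral' b V) e) V≡)))
  by-parity (no ne) = inj₂ (_ , occursAt-infix (complement l) (at-runStart (begin
    integral' (isEven i) V          ≡⟨ cong (λ b → integral' b V) (¬-not ne) ⟩
    integral' (not p) V             ≡⟨ integral'-not p V ⟩
    complement (integral' p V)      ≡⟨ cong complement V≡ ⟩
    complement (l ++ w ++ l′)       ≡⟨ complement-++₃ l w l′ ⟩
    complement l ++ complement w ++ complement l′ ∎)))
    where open ≡-Reasoning

cinf-occursInside : ArbitrarilyNormal → ∀ n {w} → length w ≤ n → Cinf w → OccursInside w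
cinf-occursInside normals _ {[]}         _ w∞ =
  occursInside normals (w∞ 0) (inj₁ (short-occurs (w∞ 0) z≤n))
cinf-occursInside normals _ {_ ∷ []}     _ w∞ =
  occursInside normals (w∞ 0) (inj₁ (short-occurs (w∞ 0) (s≤s z≤n)))
cinf-occursInside normals _ {_ ∷ _ ∷ []} _ w∞ =
  occursInside normals (w∞ 0) (inj₁ (short-occurs (w∞ 0) (s≤s (s≤s z≤n))))
cinf-occursInside normals zero    {_ ∷ _ ∷ _ ∷ _} () w∞
cinf-occursInside normals (suc n) {a ∷ b ∷ c ∷ r} (s≤s w≤n) w∞ =
  occursInside normals (w∞ 0)
    (occurs-from-deriv (w∞ 0) (w∞ 1) (cinf-occursInside normals n D≤n (cinf-deriv w∞)))
  where
  D≤n : length (deriv (a ∷ b ∷ c ∷ r)) ≤ n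
  D≤n = ≤-pred (≤-trans (Trimmed.shorter (trimmed r (w∞ 0))) (s≤s w≤n))

lemma10 : ((w : Word) → Cinf w → SubwordOfS w)
          ⇔ ((n : ℕ) → 1 ≤ n → ∃ λ k → n < k × ∃ λ m → Normal k (prefix m))
lemma10 = mk⇔
  (λ all-subwords n _ → suc n , ≤-refl , normal-prefix-exists all-subwords (suc n))
  (λ normals w w∞ → occursAt⇒subwordOfS (proj₂ (cinf-occursInside normals (length w) ≤-refl w∞)))
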